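{- Let $K$ be any configuration (with $K_{f_0}=n$) and let $f$ and $g$ be adjacent faces with $\mathrm{dist}(f_0,f)<\mathrm{dist}(f_0,g)<n$. If $f$ violates the Aztec diamond $\mathrm{Az}(n)$ but $g$ does not, then one can fire from $f$ to $g$. In the resulting configuration $K'$, $K'_f$ violates the Aztec diamond if $K_f>\mathrm{Az}(n)_f+1$, and $K'_g$ violates the Aztec diamond if $K_g=\mathrm{Az}(n)_g$.
   Context: The grid complex is the tiling of the plane by unit squares ("faces"); two faces are adjacent if they share an edge, and $\mathrm{dist}(f,g)$ is the Manhattan distance between faces. A configuration $K$ assigns an integer weight $K_f$ to each face $f$, with finitely many nonzero weights; there is a marked face $f_0$ with $K_{f_0}=n$. Firing moves: (i) if $f,g$ are adjacent faces, both different from $f_0$, with $K_f\geq K_g+2$, one may fire $f$ towards $g$, decreasing $K_f$ by $1$ and increasing $K_g$ by $1$; (ii) if $g$ is adjacent to $f_0$ and $K_g<n$, one may fire from $f_0$ to $g$, increasing $K_g$ by $1$; (iii) if $g$ is adjacent to $f_0$ and $K_g>n$, one may fire from $g$ to $f_0$, decreasing $K_g$ by $1$; the weight of $f_0$ never changes. The Aztec diamond $\mathrm{Az}(n)$ has $\mathrm{Az}(n)_{f_0}=n$ and $\mathrm{Az}(n)_f=\max\{n-\mathrm{dist}(f_0,f)+1,0\}$ for $f\neq f_0$. A face $f$ violates the Aztec diamond in $K$ if $K_f>\mathrm{Az}(n)_f$. -}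

module Defs where

open import Data.Nat as ℕ using (ℕ; suc; _∸_)
open import Data.Integer as ℤ using (ℤ; +_; _-_; ∣_∣)
open import Data.Integer.Properties as ℤP using ()
open import Data.Product using (_×_; _,_; ∃)
open import Data.Product.Properties using (≡-dec)
open import Data.List using (List)
open import Data.List.Membership.Propositional using (_∈_)
open import Data.Bool using (if_then_else_)
open import Relation.Nullary using (¬_; does)
open import Relation.Binary.PropositionalEquality using (_≡_)

-- Faces of the grid complex: unit squares, indexed by integer coordinates.
Face : Set
Face = ℤ × ℤ

_≟F_ : (f g : Face) → Relation.Nullary.Dec (f ≡ g)
_≟F_ = ≡-dec ℤP._≟_ ℤP._≟_

dist : Face → Face → ℕ
dist (a , b) (c , d) = ∣ a - c ∣ ℕ.+ ∣ b - d ∣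

Adjacent : Face → Face → Set
Adjacent f g = dist f g ≡ 1

Config : Set
Config = Face → ℤ

FiniteSupport : Config → Set
FiniteSupport K = ∃ λ (L : List Face) → ∀ h → ¬ (K h ≡ + 0) → h ∈ L

Az : Face → ℕ → Config
Az f0 n f = if does (f ≟F f0) then + n else + (suc n ∸ dist f0 f)

Violates : Face → ℕ → Config → Face → Set
Violates f0 n K f = K f ℤ.> Az f0 n f

incAt : Face → Config → Config
incAt g K h = if does (h ≟F g) then K h ℤ.+ + 1 else K h

decAt : Face → Config → Config
decAt g K h = if does (h ≟F g) then K h - + 1 else K h

data Fire (f0 : Face) (n : ℕ) (K : Config) : Face → Face → Config → Set where
  fire-i : ∀ {f g} → Adjacent f g → ¬ (f ≡ f0) → ¬ (g ≡ f0) →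
           K f ℤ.≥ K g ℤ.+ + 2 →
           Fire f0 n K f g (incAt g (decAt f K))
  fire-ii : ∀ {g} → Adjacent f0 g → K g ℤ.< + n →
            Fire f0 n K f0 g (incAt g K)
  fire-iii : ∀ {g} → Adjacent g f0 → K g ℤ.> + n →
             Fire f0 n K g f0 (decAt g K)

-- Inside radius n the Aztec diamond drops by at least one per unit of distance from f0,
-- so Az f ≥ Az g + 1. As f violates and g does not, K f ≥ Az f + 1 ≥ Az g + 2 ≥ K g + 2,
-- which is the condition for an ordinary firing; neither face is f0, since f0 carries
-- exactly Az f0 = n and g lies farther from f0 than f. Firing moves each weight by one.
module Submission where

open import Defs
open import Data.Nat as ℕ using (ℕ; _<_)
open import Data.Integer as ℤ using (ℤ; +_)
open import Data.Product using (_×_; ∃; _,_)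
open import Relation.Nullary using (¬_; yes; no)
open import Relation.Binary.PropositionalEquality
  using (_≡_; _≢_; refl; sym; trans; cong; subst; subst₂)
import Data.Nat.Properties as ℕP
import Data.Integer.Properties as ℤP
open import Data.Empty using (⊥-elim)

i<i+1 : ∀ i → i ℤ.< i ℤ.+ + 1
i<i+1 i = subst (ℤ._< i ℤ.+ + 1) (ℤP.+-identityʳ i) (ℤP.+-monoʳ-< i (ℤ.+<+ (ℕ.s≤s ℕ.z≤n)))

i+1<j⇒i<j-1 : ∀ {i j} → i ℤ.+ + 1 ℤ.< j → i ℤ.< j ℤ.- + 1
i+1<j⇒i<j-1 {i} {j} i+1<j = subst (ℤ._< j ℤ.- + 1) i+1-1≡i (ℤP.+-monoˡ-< (ℤ.- + 1) i+1<j)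
  where
  i+1-1≡i : i ℤ.+ + 1 ℤ.- + 1 ≡ i
  i+1-1≡i = trans (ℤP.+-assoc i (+ 1) (ℤ.- + 1)) (ℤP.+-identityʳ i)

≤-<-<⇒+2≤ : ∀ {i j k l} → i ℤ.≤ j → j ℤ.< k → k ℤ.< l → i ℤ.+ + 2 ℤ.≤ l
≤-<-<⇒+2≤ {i} {j} {k} {l} i≤j j<k k<l = begin
  i ℤ.+ + 2             ≤⟨ ℤP.+-monoˡ-≤ (+ 2) i≤j ⟩
  j ℤ.+ + 2             ≡⟨ trans (ℤP.+-comm j (+ 2)) (ℤP.+-assoc (+ 1) (+ 1) j) ⟩
  + 1 ℤ.+ (+ 1 ℤ.+ j)   ≤⟨ ℤP.+-monoʳ-≤ (+ 1) (ℤP.i<j⇒suc[i]≤j j<k) ⟩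
  + 1 ℤ.+ k             ≤⟨ ℤP.i<j⇒suc[i]≤j k<l ⟩
  l                     ∎
  where open ℤP.≤-Reasoning

dist-refl : ∀ f → dist f f ≡ 0
dist-refl (a , b) rewrite ℤP.+-inverseʳ a | ℤP.+-inverseʳ b = refl

dist-<⇒≢ : ∀ {h f g} → dist h f < dist h g → g ≢ h
dist-<⇒≢ {h} {f} d< refl = ℕP.n≮0 (subst (dist h f <_) (dist-refl h) d<)

incAt-self : ∀ g K → incAt g K g ≡ K g ℤ.+ + 1
incAt-self g K with g ≟F g
... | yes _ = refl
... | no g≢g = ⊥-elim (g≢g refl)

incAt-other : ∀ g K {h} → h ≢ g → incAt g K h ≡ K h
incAt-other g K {h} h≢g with h ≟F g
... | yes h≡g = ⊥-elim (h≢g h≡g)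
... | no _ = refl

decAt-self : ∀ g K → decAt g K g ≡ K g ℤ.- + 1
decAt-self g K with g ≟F g
... | yes _ = refl
... | no g≢g = ⊥-elim (g≢g refl)

decAt-other : ∀ g K {h} → h ≢ g → decAt g K h ≡ K h
decAt-other g K {h} h≢g with h ≟F g
... | yes h≡g = ⊥-elim (h≢g h≡g)
... | no _ = refl

fire-source : ∀ {f g} K → f ≢ g → incAt g (decAt f K) f ≡ K f ℤ.- + 1
fire-source {f} {g} K f≢g = trans (incAt-other g (decAt f K) f≢g) (decAt-self f K)

fire-target : ∀ {f g} K → f ≢ g → incAt g (decAt f K) g ≡ K g ℤ.+ + 1
fire-target {f} {g} K f≢g =
  trans (incAt-self g (decAt f K)) (cong (ℤ._+ + 1) (decAt-other f K (λ g≡f → f≢g (sym g≡f))))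

Az-marked : ∀ f0 n → Az f0 n f0 ≡ + n
Az-marked f0 n with f0 ≟F f0
... | yes _ = refl
... | no f0≢f0 = ⊥-elim (f0≢f0 refl)

Az-unmarked : ∀ f0 n {f} → f ≢ f0 → Az f0 n f ≡ + (ℕ.suc n ℕ.∸ dist f0 f)
Az-unmarked f0 n {f} f≢f0 with f ≟F f0
... | yes f≡f0 = ⊥-elim (f≢f0 f≡f0)
... | no _ = refl

Az-strictly-antitone : ∀ f0 n {f g} → f ≢ f0 → g ≢ f0 →
  dist f0 f < dist f0 g → dist f0 g ℕ.≤ ℕ.suc n → Az f0 n g ℤ.< Az f0 n f
Az-strictly-antitone f0 n f≢f0 g≢f0 d< d≤ =
  subst₂ ℤ._<_ (sym (Az-unmarked f0 n g≢f0)) (sym (Az-unmarked f0 n f≢f0))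
    (ℤ.+<+ (ℕP.∸-monoʳ-< d< d≤))

violates⇒≢marked : ∀ {f0 n K f} → K f0 ≡ + n → Violates f0 n K f → f ≢ f0
violates⇒≢marked {f0} {n} Kf0≡n vf refl =
  ℤP.<-irrefl (trans (Az-marked f0 n) (sym Kf0≡n)) vf

lemma5p4 : (n : ℕ) (f0 : Face) (K : Config) → FiniteSupport K → K f0 ≡ + n →
    (f g : Face) → Adjacent f g → dist f0 f < dist f0 g → dist f0 g < n →
    Violates f0 n K f → ¬ Violates f0 n K g →
    ∃ λ (K' : Config) → Fire f0 n K f g K'
      × (K f ℤ.> Az f0 n f ℤ.+ + 1 → Violates f0 n K' f)
      × (K g ≡ Az f0 n g → Violates f0 n K' g)
lemma5p4 n f0 K _ Kf0≡n f g adj d< d<n vf ¬vg =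
  incAt g (decAt f K) , fire-i adj f≢f0 g≢f0 gap , still-violates-f , now-violates-g
  where
  f≢f0 : f ≢ f0
  f≢f0 = violates⇒≢marked Kf0≡n vf
  g≢f0 : g ≢ f0
  g≢f0 = dist-<⇒≢ d<
  f≢g : f ≢ g
  f≢g refl = ℕP.<-irrefl refl d<
  gap : K f ℤ.≥ K g ℤ.+ + 2
  gap = ≤-<-<⇒+2≤ (ℤP.≮⇒≥ ¬vg)
          (Az-strictly-antitone f0 n f≢f0 g≢f0 d< (ℕP.<⇒≤ (ℕP.m<n⇒m<1+n d<n))) vf
  still-violates-f : K f ℤ.> Az f0 n f ℤ.+ + 1 → Violates f0 n (incAt g (decAt f K)) f
  still-violates-f big = subst (Az f0 n f ℤ.<_) (sym (fire-source K f≢g)) (i+1<j⇒i<j-1 big)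
  now-violates-g : K g ≡ Az f0 n g → Violates f0 n (incAt g (decAt f K)) g
  now-violates-g tight = subst₂ ℤ._<_ tight (sym (fire-target K f≢g)) (i<i+1 (K g))
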